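{- Let $\mathbb{F}$ be a field of characteristic $0$ and $n,d$ positive integers. As an $\mathbb{F}\mathrm{S}_{dn}$-module under the diagonal action, $\mathcal{P}(d)\otimes\overline{\mathcal{P}}(d)$ is isomorphic to $\bigoplus_D\mathcal{R}(\delta(D))$, where $D$ runs over all $(d,n)$-correlated diagrams.
   Context: $\mathcal{P}(d)$ is the $\mathbb{F}$-vector space spanned by symbols $[S]$ for $d\times n$ arrays $S$ containing each of $1,\dots,dn$ exactly once, subject to: exchanging two entries in the same row multiplies the symbol by $-1$; $\overline{\mathcal{P}}(d)$ is an identical copy with entries written $\bar 1,\dots,\overline{dn}$. $\mathrm{S}_{dn}$ acts diagonally on $\mathcal{P}(d)\otimes\overline{\mathcal{P}}(d)$: $\sigma$ sends $[S]\otimes[\bar T]$ to $[S^\sigma]\otimes[\bar T^\sigma]$, replacing each entry $k$ (resp. $\bar k$) by $\sigma(k)$ (resp. $\overline{\sigma(k)}$). A $(d,n)$-correlated diagram is a $d\times d$ matrix over $\mathbb{N}$ with all row and column sums equal to $n$; $\delta(D)$ is the partition of $dn$ obtained by arranging the nonzero entries of $D$ in non-increasing order. For $\lambda\vdash s$, a row tabloid of shape $\lambda$ is a filling of the Young diagram of $\lambda$ by $[s]$ without repetition, modulo identifying fillings whose corresponding rows have the same sets of entries; $\mathcal{R}(\lambda)$ is the $\mathbb{F}\mathrm{S}_s$-module spanned by the row tabloids of shape $\lambda$, with $\mathrm{S}_s$ permuting entries. -}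

module Defs where

open import Level using (Level; _⊔_) renaming (suc to lsuc)
open import Algebra.Bundles using (CommutativeRing)
open import Data.Nat using (ℕ; zero; suc; _<ᵇ_; _≡ᵇ_)
import Data.Nat as N
open import Data.Fin using (Fin; toℕ; _≟_)
open import Data.Vec using (Vec; []; _∷_; lookup; tabulate; transpose; concat; toList; countᵇ)
import Data.Vec as V
open import Data.List using (List; []; _∷_; length; filter)
open import Data.Bool using (Bool; true; false; _∧_; if_then_else_; not)
open import Data.Product using (Σ; _×_; _,_)
open import Data.Fin.Permutation using (Permutation′; _⟨$⟩ʳ_)
open import Relation.Nullary using (¬_; does)
open import Relation.Binary.PropositionalEquality using (_≡_)

record Field (c ℓ : Level) : Set (lsuc (c ⊔ ℓ)) where
  field
    commutativeRing : CommutativeRing c ℓ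
  open CommutativeRing commutativeRing public
  field
    0≉1     : ¬ (0# ≈ 1#)
    inverse : ∀ x → ¬ (x ≈ 0#) → Σ Carrier (λ y → x * y ≈ 1#)

module _ {c ℓ} (F : Field c ℓ) where
  open Field F

  natEmbed : ℕ → Carrier
  natEmbed zero    = 0#
  natEmbed (suc m) = 1# + natEmbed m

  CharacteristicZero : Set ℓ
  CharacteristicZero = ∀ m → ¬ (natEmbed (suc m) ≈ 0#)

  signPow : ℕ → Carrier → Carrier
  signPow zero    x = x
  signPow (suc k) x = - signPow k x

allFinᵇ : ∀ {k} → (Fin k → Bool) → Bool
allFinᵇ p = Data.Vec.foldr _ _∧_ true (tabulate p)

sumFin : ∀ {k} → (Fin k → ℕ) → ℕ
sumFin f = V.sum (tabulate f)

_∘ₚ_ : ∀ {A : Set} {k} → Vec A k → Permutation′ k → Vec A k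
f ∘ₚ σ = tabulate (λ a → lookup f (σ ⟨$⟩ʳ a))

-- The module itself is the space of coefficient functions
-- supported on the basis indices.

record Rep {c ℓ} (F : Field c ℓ) (m : ℕ) : Set (lsuc c ⊔ ℓ) where
  open Field F
  field
    Idx   : Set
    basis : Idx → Bool
    act   : Permutation′ m → (Idx → Carrier) → (Idx → Carrier)

module _ {c ℓ} (F : Field c ℓ) {m : ℕ} where
  open Field F

  _≋_ : {I : Set} → (I → Carrier) → (I → Carrier) → Set (ℓ)
  v ≋ w = ∀ i → v i ≈ w i

  Supported : {I : Set} → (I → Bool) → (I → Carrier) → Set ℓ
  Supported b v = ∀ i → b i ≡ false → v i ≈ 0#

  Isomorphic : Rep F m → Rep F m → Set (c ⊔ ℓ)
  Isomorphic M N =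
    Σ ((Rep.Idx M → Carrier) → (Rep.Idx N → Carrier)) λ φ →
    Σ ((Rep.Idx N → Carrier) → (Rep.Idx M → Carrier)) λ ψ →
      Lin φ × Lin ψ ×
      (∀ v → Supported (Rep.basis M) v → Supported (Rep.basis N) (φ v)) ×
      (∀ w → Supported (Rep.basis N) w → Supported (Rep.basis M) (ψ w)) ×
      (∀ v → Supported (Rep.basis M) v → ψ (φ v) ≋ v) ×
      (∀ w → Supported (Rep.basis N) w → φ (ψ w) ≋ w) ×
      (∀ σ v → Supported (Rep.basis M) v →
         φ (Rep.act M σ v) ≋ Rep.act N σ (φ v))
    where
    Lin : {I J : Set} → ((I → Carrier) → (J → Carrier)) → Set (c ⊔ ℓ)
    Lin φ =
      (∀ v w → v ≋ w → φ v ≋ φ w) ×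
      (∀ v w → φ (λ i → v i + w i) ≋ (λ j → φ v j + φ w j)) ×
      (∀ a v → φ (λ i → a * v i) ≋ (λ j → a * φ v j))

-- Basis of P(d): the symbols [S] with S row-increasing; such S is encoded
-- by the word f : Fin (d*n) → Fin d sending each entry to its row
-- (each row index occurring exactly n times).

PIdx : ℕ → ℕ → Set
PIdx d n = Vec (Fin d) (d N.* n)

isRowWord : ∀ d n → PIdx d n → Bool
isRowWord d n f = allFinᵇ (λ i → countᵇ (λ x → does (x ≟ i)) f ≡ᵇ n)

-- number of pairs a < b lying in the same row of f with σ a > σ b;
-- (-1)^this is the sign needed to re-sort the rows of S_f^σ.
rowInversions : ∀ {d k} → Permutation′ k → Vec (Fin d) k → ℕ
rowInversions σ f =
  sumFin (λ a → sumFin (λ b →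
    if (toℕ a <ᵇ toℕ b) ∧ does (lookup f a ≟ lookup f b)
         ∧ (toℕ (σ ⟨$⟩ʳ b) <ᵇ toℕ (σ ⟨$⟩ʳ a))
    then 1 else 0))

-- σ · [S_f] ⊗ [S̄_g] = ε(σ,f) ε(σ,g) [S_{f∘σ⁻¹}] ⊗ [S̄_{g∘σ⁻¹}],
-- written on coefficient functions.
PtensorPbar : ∀ {c ℓ} (F : Field c ℓ) (d n : ℕ) → Rep F (d N.* n)
PtensorPbar F d n = record
  { Idx   = PIdx d n × PIdx d n
  ; basis = λ { (f , g) → isRowWord d n f ∧ isRowWord d n g }
  ; act   = λ σ v → λ { (f , g) →
      signPow F (rowInversions σ (f ∘ₚ σ) N.+ rowInversions σ (g ∘ₚ σ))
                (v (f ∘ₚ σ , g ∘ₚ σ)) }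
  }

Diagram : ℕ → Set
Diagram d = Vec (Vec ℕ d) d

isCorrelated : ∀ d n → Diagram d → Bool
isCorrelated d n D =
  allFinᵇ (λ i → V.sum (lookup D i) ≡ᵇ n) ∧
  allFinᵇ (λ j → V.sum (lookup (transpose D) j) ≡ᵇ n)

insertDesc : ℕ → List ℕ → List ℕ
insertDesc x [] = x ∷ []
insertDesc x (y ∷ ys) = if y <ᵇ x then x ∷ y ∷ ys else y ∷ insertDesc x ys

sortDesc : List ℕ → List ℕ
sortDesc [] = []
sortDesc (x ∷ xs) = insertDesc x (sortDesc xs)

δ : ∀ {d} → Diagram d → List ℕ
δ D = sortDesc (filter (λ x → not (x ≡ᵇ 0) Data.Bool.≟ true) (toList (concat D)))

-- a row tabloid of shape λ = (λ₀,…,λ_{ℓ-1}) on [s] is encoded by the word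
-- t : Fin s → ℕ sending each entry to its row; row i has exactly λᵢ entries.
rowSizesFrom : ∀ {s} → ℕ → List ℕ → Vec ℕ s → Bool
rowSizesFrom i [] t = true
rowSizesFrom i (l ∷ ls) t = (countᵇ (λ x → x ≡ᵇ i) t ≡ᵇ l) ∧ rowSizesFrom (suc i) ls t

isTabloid : ∀ {s} → List ℕ → Vec ℕ s → Bool
isTabloid λs t = Data.Vec.foldr _ _∧_ true (V.map (λ x → x <ᵇ length λs) t)
                 ∧ rowSizesFrom 0 λs t

-- ⊕_D R(δ(D)): basis = pairs (D, row tabloid of shape δ(D)), σ permuting entries.
SumR : ∀ {c ℓ} (F : Field c ℓ) (d n : ℕ) → Rep F (d N.* n)
SumR F d n = record
  { Idx   = Diagram d × Vec ℕ (d N.* n)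
  ; basis = λ { (D , t) → isCorrelated d n D ∧ isTabloid (δ D) t }
  ; act   = λ σ v → λ { (D , t) → v (D , t ∘ₚ σ) }
  }

-- Both sides have bases permuted by S_{dn}, up to sign on the left: pairs
-- (f, g) of row words (f a = row of entry a in S) and pairs (D, t) of a
-- correlated diagram and a row tabloid of shape δ(D).  The isomorphism is a
-- signed bijection of these bases.  (f, g) is sent to (D, t), where D counts
-- the cells (f a, g a) and t puts a into the row of δ(D) belonging to the
-- cell (f a, g a), the nonzero cells being listed by decreasing entry.  The
-- sign by which σ acts on [S_f] is (-1)^(inv(f∘σ) + inv f + inv σ) — a
-- coboundary — so twisting the bijection by (-1)^(inv f + inv g) makes it
-- equivariant.
-- Neither characteristic 0 nor n ≥ 1 is needed; d ≥ 1 provides a default cell.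
module Submission where

open import Defs
open import Data.Nat using (ℕ; zero; suc; _+_; _*_; _<_; _≤_; _<ᵇ_; _≡ᵇ_; z≤n; s≤s)
open import Data.Nat using () renaming (_≟_ to _≟ℕ_)
open import Data.Nat.DivMod using (_%_; %-distribˡ-+; [m+kn]%n≡m%n)
open import Data.Nat.Properties
  using ( +-*-semiring; *-comm; +-identityʳ; +-suc; m≤m+n; m≤n+m; ≤-trans; ≤-refl; *-cancelˡ-≡
        ; ≡ᵇ⇒≡; ≡⇒≡ᵇ; <ᵇ⇒<; <⇒<ᵇ)
open import Data.Nat.Tactic.RingSolver using (solve-∀)
open import Data.Bool using (Bool; true; false; T; if_then_else_; _∧_; not)
import Data.Bool as Bool
open import Data.Bool.Properties using (T-≡; T-∧; ∧-comm)
open import Function.Bundles using (Equivalence; _⇔_; mk⇔)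
open import Data.Fin using (Fin; zero; suc; toℕ; _≟_)
open import Data.Fin.Properties using (toℕ-injective)
open import Data.Fin.Permutation using (Permutation′; _⟨$⟩ʳ_; _⟨$⟩ˡ_; inverseʳ; inverseˡ)
open import Data.Vec using (Vec; []; _∷_; lookup; tabulate; countᵇ; transpose; toList; concat; zip)
import Data.Vec as V
import Data.Vec.Properties as VP
open import Data.Product using (_×_; _,_; proj₁; proj₂)
open import Data.List using (List; []; _∷_; _++_; length; cartesianProduct; allFin)
import Data.List as List
import Data.List.Properties as LP
open import Data.List.Membership.Propositional.Properties using (∈-filter⁺; ∈-filter⁻; ∈-cartesianProduct⁺; ∈-allFin)
import Data.List.Relation.Unary.Unique.Propositional.Properties as UP
open import Data.List.Membership.Propositional using (_∈_)
open import Data.List.Relation.Unary.Any using (here; there)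
import Data.List.Relation.Unary.All as All
open import Data.List.Relation.Unary.AllPairs using (_∷_)
open import Data.List.Relation.Unary.Unique.Propositional using (Unique)
open import Data.List.Relation.Binary.Permutation.Propositional
  using (_↭_; ↭-refl; ↭-sym; ↭-trans; ↭-prep; ↭-swap; ↭⇒↭ₛ)
open import Data.List.Relation.Binary.Permutation.Propositional.Properties using (∈-resp-↭)
open import Relation.Binary.Definitions using (DecidableEquality)
open import Relation.Nullary using (Dec; does; ¬_; yes; no; contradiction)
open import Relation.Nullary.Decidable using (map′; _×-dec_; dec-true; dec-false; does-⇔)
open import Relation.Binary.PropositionalEquality
  using (_≡_; refl; sym; trans; cong; cong₂; subst; subst₂; module ≡-Reasoning)
import Relation.Binary.PropositionalEquality as ≡
open import Algebra.Properties.Semiring.Sum +-*-semiring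
  using (sum; sum-cong-≗; ∑-comm; ∑-distrib-+; sum-permute; *-distribˡ-sum; sum-replicate-zero)

𝟙 : Bool → ℕ
𝟙 b = if b then 1 else 0

T-≡-ext : ∀ {a b} → T a ⇔ T b → a ≡ b
T-≡-ext {false} {false} _   = refl
T-≡-ext {false} {true}  a⇔b = contradiction (a⇔b .Equivalence.from _) λ ()
T-≡-ext {true}  {false} a⇔b = contradiction (a⇔b .Equivalence.to _) λ ()
T-≡-ext {true}  {true}  _   = refl

sumFin≡sum : ∀ {k} (f : Fin k → ℕ) → sumFin f ≡ sum f
sumFin≡sum {zero}  f = refl
sumFin≡sum {suc k} f = cong (f zero +_) (sumFin≡sum (λ a → f (suc a)))

countᵇ≡sum : ∀ {A : Set} {k} (p : A → Bool) (v : Vec A k) →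
  countᵇ p v ≡ sum (λ a → 𝟙 (p (lookup v a)))
countᵇ≡sum p []      = refl
countᵇ≡sum p (x ∷ v) with p x
... | true  = cong suc (countᵇ≡sum p v)
... | false = countᵇ≡sum p v

sum-zero : ∀ {k} (f : Fin k → ℕ) → (∀ a → f a ≡ 0) → sum f ≡ 0
sum-zero {k} f f≡0 = trans (sum-cong-≗ f≡0) (sum-replicate-zero k)

sum-≥ : ∀ {k} (f : Fin k → ℕ) a → f a ≤ sum f
sum-≥ f zero    = m≤m+n _ _
sum-≥ f (suc a) = ≤-trans (sum-≥ (λ x → f (suc x)) a) (m≤n+m _ _)

sum-δ : ∀ {d} (i : Fin d) → sum (λ j → 𝟙 (does (i ≟ j))) ≡ 1
sum-δ {suc d} zero    = cong suc (sum-zero {d} (λ _ → 0) (λ _ → refl))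
sum-δ {suc d} (suc i) = sum-δ {d} i

lookup-∘ₚ : ∀ {A : Set} {k} (t : Vec A k) (σ : Permutation′ k) a → lookup (t ∘ₚ σ) a ≡ lookup t (σ ⟨$⟩ʳ a)
lookup-∘ₚ t σ a = VP.lookup∘tabulate _ a

module _ {A : Set} where

  countᵇ-cong : ∀ {k} (p q : A → Bool) (v : Vec A k) →
    (∀ a → p (lookup v a) ≡ q (lookup v a)) → countᵇ p v ≡ countᵇ q v
  countᵇ-cong {k} p q v p≡q = begin
    countᵇ p v                       ≡⟨ countᵇ≡sum p v ⟩
    sum (λ a → 𝟙 (p (lookup v a)))   ≡⟨ sum-cong-≗ {k} (λ a → cong 𝟙 (p≡q a)) ⟩
    sum (λ a → 𝟙 (q (lookup v a)))   ≡⟨ countᵇ≡sum q v ⟨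
    countᵇ q v                       ∎
    where open ≡-Reasoning

  countᵇ-map : ∀ {B : Set} {k} (p : B → Bool) (h : A → B) (v : Vec A k) →
    countᵇ p (V.map h v) ≡ countᵇ (λ x → p (h x)) v
  countᵇ-map p h []      = refl
  countᵇ-map p h (x ∷ v) with p (h x)
  ... | true  = cong suc (countᵇ-map p h v)
  ... | false = countᵇ-map p h v

  countᵇ-∘ₚ : ∀ {k} (p : A → Bool) (v : Vec A k) (σ : Permutation′ k) →
    countᵇ p (v ∘ₚ σ) ≡ countᵇ p v
  countᵇ-∘ₚ {k} p v σ = begin
    countᵇ p (v ∘ₚ σ)                           ≡⟨ countᵇ≡sum p (v ∘ₚ σ) ⟩
    sum (λ a → 𝟙 (p (lookup (v ∘ₚ σ) a)))       ≡⟨ sum-cong-≗ {k} (λ a → cong (λ x → 𝟙 (p x)) (lookup-∘ₚ v σ a)) ⟩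
    sum (λ a → 𝟙 (p (lookup v (σ ⟨$⟩ʳ a))))     ≡⟨ sum-permute (λ a → 𝟙 (p (lookup v a))) σ ⟨
    sum (λ a → 𝟙 (p (lookup v a)))              ≡⟨ countᵇ≡sum p v ⟨
    countᵇ p v                                  ∎
    where open ≡-Reasoning

  countᵇ-none : ∀ {k} (p : A → Bool) (v : Vec A k) →
    (∀ a → p (lookup v a) ≡ false) → countᵇ p v ≡ 0
  countᵇ-none p v none = trans (countᵇ≡sum p v) (sum-zero _ (λ a → cong 𝟙 (none a)))

  countᵇ-some : ∀ {k} (p : A → Bool) (v : Vec A k) a →
    p (lookup v a) ≡ true → ¬ (countᵇ p v ≡ 0)
  countᵇ-some p v a pa count≡0
    with () ← subst (1 ≤_) (trans (sym (countᵇ≡sum p v)) count≡0)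
                (≤-trans (subst (λ b → 1 ≤ 𝟙 b) (sym pa) ≤-refl) (sum-≥ _ a))

-- Three-valued comparison of natural numbers.  Phrasing every order test
-- through it turns the sign computation below into a finite table.
data Cmp : Set where
  lt eq gt : Cmp

cmp : ℕ → ℕ → Cmp
cmp zero    zero    = eq
cmp zero    (suc _) = lt
cmp (suc _) zero    = gt
cmp (suc x) (suc y) = cmp x y

flipᶜ : Cmp → Cmp
flipᶜ lt = gt
flipᶜ eq = eq
flipᶜ gt = lt

isLt isEq isGt : Cmp → Bool
isLt lt = true
isLt _  = false
isEq eq = true
isEq _  = false
isGt gt = true
isGt _  = false

<ᵇ-cmp : ∀ x y → (x <ᵇ y) ≡ isLt (cmp x y)
<ᵇ-cmp zero    zero    = refl
<ᵇ-cmp zero    (suc y) = refl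
<ᵇ-cmp (suc x) zero    = refl
<ᵇ-cmp (suc x) (suc y) = <ᵇ-cmp x y

>ᵇ-cmp : ∀ x y → (y <ᵇ x) ≡ isGt (cmp x y)
>ᵇ-cmp zero    zero    = refl
>ᵇ-cmp zero    (suc y) = refl
>ᵇ-cmp (suc x) zero    = refl
>ᵇ-cmp (suc x) (suc y) = >ᵇ-cmp x y

cmp-flip : ∀ x y → cmp y x ≡ flipᶜ (cmp x y)
cmp-flip zero    zero    = refl
cmp-flip zero    (suc y) = refl
cmp-flip (suc x) zero    = refl
cmp-flip (suc x) (suc y) = cmp-flip x y

cmp≡eq : ∀ x y → cmp x y ≡ eq → x ≡ y
cmp≡eq zero    zero    _ = refl
cmp≡eq (suc x) (suc y) e = cong suc (cmp≡eq x y e)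

cmp-refl : ∀ x → cmp x x ≡ eq
cmp-refl zero    = refl
cmp-refl (suc x) = cmp-refl x

does-≟-cmp : ∀ {d} (i j : Fin d) → does (i ≟ j) ≡ isEq (cmp (toℕ i) (toℕ j))
does-≟-cmp zero    zero    = refl
does-≟-cmp zero    (suc j) = refl
does-≟-cmp (suc i) zero    = refl
does-≟-cmp (suc i) (suc j) = does-≟-cmp i j

ΣΣ : ∀ {k} → (Fin k → Fin k → ℕ) → ℕ
ΣΣ h = sum (λ a → sum (λ b → h a b))

module _ {k : ℕ} where

  ΣΣ-cong : {h h′ : Fin k → Fin k → ℕ} → (∀ a b → h a b ≡ h′ a b) → ΣΣ h ≡ ΣΣ h′
  ΣΣ-cong h≡h′ = sum-cong-≗ {k} (λ a → sum-cong-≗ {k} (h≡h′ a))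

  ΣΣ-+ : (h h′ : Fin k → Fin k → ℕ) → ΣΣ (λ a b → h a b + h′ a b) ≡ ΣΣ h + ΣΣ h′
  ΣΣ-+ h h′ = trans (sum-cong-≗ {k} (λ a → ∑-distrib-+ (h a) (h′ a)))
                    (∑-distrib-+ (λ a → sum (h a)) (λ a → sum (h′ a)))

  ΣΣ-*ˡ : ∀ c (h : Fin k → Fin k → ℕ) → ΣΣ (λ a b → c * h a b) ≡ c * ΣΣ h
  ΣΣ-*ˡ c h = sym (trans (*-distribˡ-sum c (λ a → sum (h a)))
                         (sum-cong-≗ {k} (λ a → *-distribˡ-sum c (h a))))

  sumFin²≡ΣΣ : (h : Fin k → Fin k → ℕ) → sumFin (λ a → sumFin (λ b → h a b)) ≡ ΣΣ h
  sumFin²≡ΣΣ h = trans (sumFin≡sum (λ a → sumFin (h a))) (sum-cong-≗ {k} (λ a → sumFin≡sum (h a)))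

  ΣΣ-permute : (h : Fin k → Fin k → ℕ) (σ : Permutation′ k) →
    ΣΣ h ≡ ΣΣ (λ a b → h (σ ⟨$⟩ʳ a) (σ ⟨$⟩ʳ b))
  ΣΣ-permute h σ = trans (sum-permute (λ a → sum (h a)) σ)
                         (sum-cong-≗ {k} (λ a → sum-permute (h (σ ⟨$⟩ʳ a)) σ))

  ΣΣ-symmetric : (h : Fin k → Fin k → ℕ) → ΣΣ (λ a b → h a b + h b a) ≡ 2 * ΣΣ h
  ΣΣ-symmetric h = begin
    ΣΣ (λ a b → h a b + h b a)   ≡⟨ ΣΣ-+ h (λ a b → h b a) ⟩
    ΣΣ h + ΣΣ (λ a b → h b a)    ≡⟨ cong (ΣΣ h +_) (∑-comm (λ a b → h b a)) ⟩
    ΣΣ h + ΣΣ h                  ≡⟨ double (ΣΣ h) ⟩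
    2 * ΣΣ h                     ∎
    where
    open ≡-Reasoning
    double : ∀ x → x + x ≡ 2 * x
    double = solve-∀

  ΣΣ-symmetrize : (L X R : Fin k → Fin k → ℕ) →
    (∀ a b → L a b + L b a + 2 * (X a b + X b a) ≡ R a b + R b a) →
    ΣΣ L + 2 * ΣΣ X ≡ ΣΣ R
  ΣΣ-symmetrize L X R pairwise = *-cancelˡ-≡ _ _ 2 (begin
    2 * (ΣΣ L + 2 * ΣΣ X)
      ≡⟨ distrib (ΣΣ L) (ΣΣ X) ⟩
    2 * ΣΣ L + 2 * (2 * ΣΣ X)
      ≡⟨ cong₂ (λ u w → u + 2 * w) (ΣΣ-symmetric L) (ΣΣ-symmetric X) ⟨
    ΣΣ L′ + 2 * ΣΣ X′
      ≡⟨ cong (ΣΣ L′ +_) (ΣΣ-*ˡ 2 X′) ⟨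
    ΣΣ L′ + ΣΣ (λ a b → 2 * X′ a b)
      ≡⟨ ΣΣ-+ L′ (λ a b → 2 * X′ a b) ⟨
    ΣΣ (λ a b → L′ a b + 2 * X′ a b)
      ≡⟨ ΣΣ-cong pairwise ⟩
    ΣΣ (λ a b → R a b + R b a)
      ≡⟨ ΣΣ-symmetric R ⟩
    2 * ΣΣ R ∎)
    where
    open ≡-Reasoning
    L′ X′ : Fin k → Fin k → ℕ
    L′ a b = L a b + L b a
    X′ a b = X a b + X b a
    distrib : ∀ l x → 2 * (l + 2 * x) ≡ 2 * l + 2 * (2 * x)
    distrib = solve-∀

inversions : ∀ {k} → (Fin k → ℕ) → ℕ
inversions h = ΣΣ (λ a b → 𝟙 ((toℕ a <ᵇ toℕ b) ∧ (h b <ᵇ h a)))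

letters : ∀ {d k} → Vec (Fin d) k → Fin k → ℕ
letters f a = toℕ (lookup f a)

images : ∀ {k} → Permutation′ k → Fin k → ℕ
images σ a = toℕ (σ ⟨$⟩ʳ a)

inversion-term : ∀ x y z w → 𝟙 ((x <ᵇ y) ∧ (w <ᵇ z)) ≡ 𝟙 (isLt (cmp x y) ∧ isGt (cmp z w))
inversion-term x y z w rewrite <ᵇ-cmp x y | >ᵇ-cmp z w = refl

-- Contributions of an ordered pair of positions (a, b), in terms of the
-- comparisons c₁ of a and b, c₂ of their images under σ, and c₃ of the
-- letters at a and b of g = f ∘ σ (for a < b):
--   Lᶜ : (a, b) is an inversion of g, or a tie of g inverted by σ;
--   Rᶜ : (σ a, σ b) is an inversion of f, or (a, b) is an inversion of σ;
--   Xᶜ : the correction term, (a, b) inverted by σ but increasing in g.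
Lᶜ Xᶜ Rᶜ : Cmp → Cmp → Cmp → ℕ
Lᶜ c₁ c₂ c₃ = 𝟙 (isLt c₁ ∧ isGt c₃) + 𝟙 (isLt c₁ ∧ isEq c₃ ∧ isGt c₂)
Xᶜ c₁ c₂ c₃ = 𝟙 (isLt c₁ ∧ isGt c₂ ∧ isLt c₃)
Rᶜ c₁ c₂ c₃ = 𝟙 (isLt c₂ ∧ isGt c₃) + 𝟙 (isLt c₁ ∧ isGt c₂)

-- On each unordered pair the two sides agree up to twice the correction.
-- Positions are equal exactly when their images are (σ is injective).
pair-table : ∀ c₁ c₂ c₃ → (c₁ ≡ eq → c₂ ≡ eq) → (c₂ ≡ eq → c₁ ≡ eq) →
  Lᶜ c₁ c₂ c₃ + Lᶜ (flipᶜ c₁) (flipᶜ c₂) (flipᶜ c₃)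
    + 2 * (Xᶜ c₁ c₂ c₃ + Xᶜ (flipᶜ c₁) (flipᶜ c₂) (flipᶜ c₃))
  ≡ Rᶜ c₁ c₂ c₃ + Rᶜ (flipᶜ c₁) (flipᶜ c₂) (flipᶜ c₃)
pair-table lt lt lt _ _ = refl
pair-table lt lt eq _ _ = refl
pair-table lt lt gt _ _ = refl
pair-table lt gt lt _ _ = refl
pair-table lt gt eq _ _ = refl
pair-table lt gt gt _ _ = refl
pair-table gt lt lt _ _ = refl
pair-table gt lt eq _ _ = refl
pair-table gt lt gt _ _ = refl
pair-table gt gt lt _ _ = refl
pair-table gt gt eq _ _ = refl
pair-table gt gt gt _ _ = refl
pair-table eq eq _  _ _ = refl
pair-table lt eq _  _ h with () ← h refl
pair-table gt eq _  _ h with () ← h refl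
pair-table eq lt _  h _ with () ← h refl
pair-table eq gt _  h _ with () ← h refl

module RowSign {d k : ℕ} (σ : Permutation′ k) (f : Vec (Fin d) k) where

  g : Vec (Fin d) k
  g = f ∘ₚ σ

  c₁ c₂ c₃ : Fin k → Fin k → Cmp
  c₁ a b = cmp (toℕ a) (toℕ b)
  c₂ a b = cmp (images σ a) (images σ b)
  c₃ a b = cmp (letters g a) (letters g b)

  comparisons : (Cmp → Cmp → Cmp → ℕ) → Fin k → Fin k → ℕ
  comparisons t a b = t (c₁ a b) (c₂ a b) (c₃ a b)

  σ-preserves-ties : ∀ a b → cmp (toℕ a) (toℕ b) ≡ eq → cmp (images σ a) (images σ b) ≡ eq
  σ-preserves-ties a b a≈b with refl ← toℕ-injective {i = a} {b} (cmp≡eq (toℕ a) (toℕ b) a≈b) = cmp-refl (images σ a)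

  σ-reflects-ties : ∀ a b → cmp (images σ a) (images σ b) ≡ eq → cmp (toℕ a) (toℕ b) ≡ eq
  σ-reflects-ties a b σa≈σb = subst (λ x → cmp (toℕ a) (toℕ x) ≡ eq) a≡b (cmp-refl (toℕ a))
    where
    a≡b : a ≡ b
    a≡b = trans (sym (inverseˡ σ))
                (trans (cong (σ ⟨$⟩ˡ_) (toℕ-injective (cmp≡eq (images σ a) (images σ b) σa≈σb))) (inverseˡ σ))

  pairwise : ∀ a b →
    comparisons Lᶜ a b + comparisons Lᶜ b a + 2 * (comparisons Xᶜ a b + comparisons Xᶜ b a)
    ≡ comparisons Rᶜ a b + comparisons Rᶜ b a
  pairwise a b
    rewrite cmp-flip (toℕ a) (toℕ b) | cmp-flip (images σ a) (images σ b) | cmp-flip (letters g a) (letters g b)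
    = pair-table _ _ _ (σ-preserves-ties a b) (σ-reflects-ties a b)

  ΣΣL : ΣΣ (comparisons Lᶜ) ≡ inversions (letters g) + rowInversions σ g
  ΣΣL = trans (ΣΣ-+ (λ a b → 𝟙 (isLt (c₁ a b) ∧ isGt (c₃ a b)))
                    (λ a b → 𝟙 (isLt (c₁ a b) ∧ isEq (c₃ a b) ∧ isGt (c₂ a b))))
              (cong₂ _+_ (ΣΣ-cong λ a b → sym (inversion-term (toℕ a) (toℕ b) (letters g a) (letters g b))) (sym rows))
    where
    rows : rowInversions σ g ≡ ΣΣ (λ a b → 𝟙 (isLt (c₁ a b) ∧ isEq (c₃ a b) ∧ isGt (c₂ a b)))
    rows = trans (sumFin²≡ΣΣ λ a b →
                    𝟙 ((toℕ a <ᵇ toℕ b) ∧ does (lookup g a ≟ lookup g b) ∧ (images σ b <ᵇ images σ a)))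
                 (ΣΣ-cong λ a b → cong 𝟙 (cong₂ (λ x y → x ∧ y) (<ᵇ-cmp (toℕ a) (toℕ b))
                   (cong₂ _∧_ (does-≟-cmp (lookup g a) (lookup g b)) (>ᵇ-cmp (images σ a) (images σ b)))))

  ΣΣR : ΣΣ (comparisons Rᶜ) ≡ inversions (letters f) + inversions (images σ)
  ΣΣR = trans (ΣΣ-+ (λ a b → 𝟙 (isLt (c₂ a b) ∧ isGt (c₃ a b))) (λ a b → 𝟙 (isLt (c₁ a b) ∧ isGt (c₂ a b))))
              (cong₂ _+_ (sym f-inversions) (ΣΣ-cong λ a b → sym (inversion-term (toℕ a) (toℕ b) (images σ a) (images σ b))))
    where
    g-letter : ∀ a → letters f (σ ⟨$⟩ʳ a) ≡ letters g a
    g-letter a = sym (cong toℕ (VP.lookup∘tabulate _ a))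
    f-inversions : inversions (letters f) ≡ ΣΣ (λ a b → 𝟙 (isLt (c₂ a b) ∧ isGt (c₃ a b)))
    f-inversions = trans (ΣΣ-permute _ σ) (ΣΣ-cong λ a b →
      trans (inversion-term (images σ a) (images σ b) (letters f (σ ⟨$⟩ʳ a)) (letters f (σ ⟨$⟩ʳ b)))
            (cong₂ (λ x y → 𝟙 (_ ∧ isGt (cmp x y))) (g-letter a) (g-letter b)))

  identity : inversions (letters g) + rowInversions σ g + 2 * ΣΣ (comparisons Xᶜ)
             ≡ inversions (letters f) + inversions (images σ)
  identity = begin
    inversions (letters g) + rowInversions σ g + 2 * ΣΣ (comparisons Xᶜ)
      ≡⟨ cong (_+ 2 * ΣΣ (comparisons Xᶜ)) ΣΣL ⟨
    ΣΣ (comparisons Lᶜ) + 2 * ΣΣ (comparisons Xᶜ)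
      ≡⟨ ΣΣ-symmetrize _ _ _ pairwise ⟩
    ΣΣ (comparisons Rᶜ)
      ≡⟨ ΣΣR ⟩
    inversions (letters f) + inversions (images σ) ∎
    where open ≡-Reasoning

+2*-%2 : ∀ a x → (a + 2 * x) % 2 ≡ a % 2
+2*-%2 a x = trans (cong (λ y → (a + y) % 2) (*-comm 2 x)) ([m+kn]%n≡m%n a x 2)

+-%2 : ∀ a b c d → a % 2 ≡ b % 2 → c % 2 ≡ d % 2 → (a + c) % 2 ≡ (b + d) % 2
+-%2 a b c d a≡b c≡d = begin
  (a + c) % 2                ≡⟨ %-distribˡ-+ a c 2 ⟩
  (a % 2 + c % 2) % 2        ≡⟨ cong₂ (λ x y → (x + y) % 2) a≡b c≡d ⟩
  (b % 2 + d % 2) % 2        ≡⟨ %-distribˡ-+ b d 2 ⟨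
  (b + d) % 2                ∎
  where open ≡-Reasoning

coboundary-parity : ∀ F G F′ G′ s-f s-g S →
  (F′ + s-f) % 2 ≡ (F + S) % 2 → (G′ + s-g) % 2 ≡ (G + S) % 2 →
  (F + G + (s-f + s-g)) % 2 ≡ (F′ + G′) % 2
coboundary-parity F G F′ G′ s-f s-g S f-sign g-sign = begin
  (F + G + (s-f + s-g)) % 2                   ≡⟨ +2*-%2 (F + G + (s-f + s-g)) S ⟨
  (F + G + (s-f + s-g) + 2 * S) % 2           ≡⟨ cong (_% 2) (regroup₁ F G s-f s-g S) ⟩
  ((F + S) + (G + S) + (s-f + s-g)) % 2       ≡⟨ +-%2 (F + S + (G + S)) (F′ + s-f + (G′ + s-g)) (s-f + s-g) (s-f + s-g)
                                                      (+-%2 (F + S) (F′ + s-f) (G + S) (G′ + s-g) (sym f-sign) (sym g-sign)) refl ⟩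
  ((F′ + s-f) + (G′ + s-g) + (s-f + s-g)) % 2 ≡⟨ cong (_% 2) (regroup₂ F′ G′ s-f s-g) ⟩
  (F′ + G′ + 2 * (s-f + s-g)) % 2             ≡⟨ +2*-%2 (F′ + G′) (s-f + s-g) ⟩
  (F′ + G′) % 2                               ∎
  where
  open ≡-Reasoning
  regroup₁ : ∀ F G s-f s-g S → F + G + (s-f + s-g) + 2 * S ≡ (F + S) + (G + S) + (s-f + s-g)
  regroup₁ = solve-∀
  regroup₂ : ∀ F′ G′ s-f s-g → (F′ + s-f) + (G′ + s-g) + (s-f + s-g) ≡ F′ + G′ + 2 * (s-f + s-g)
  regroup₂ = solve-∀

-- The sign rule for acting on a row-increasing tableau: moving its entries
-- by σ and re-sorting the rows costs rowInversions sign changes, which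
-- equals, modulo 2, the change in inversions of the row word plus the
-- inversions of σ.
rowInversions-parity : ∀ {d k} (f : Vec (Fin d) k) (σ : Permutation′ k) →
  (inversions (letters (f ∘ₚ σ)) + rowInversions σ (f ∘ₚ σ)) % 2
  ≡ (inversions (letters f) + inversions (images σ)) % 2
rowInversions-parity f σ =
  trans (sym (+2*-%2 (inversions (letters g) + rowInversions σ g) (ΣΣ (comparisons Xᶜ))))
        (cong (_% 2) identity)
  where open RowSign σ f

module Signs {c ℓ} (F : Field c ℓ) where
  open Field F hiding (zero)
    renaming (_+_ to _+ᶠ_; _*_ to _*ᶠ_; refl to ≈-refl; sym to ≈-sym; trans to ≈-trans)
  open import Algebra.Properties.Ring ring using (-‿+-comm; -‿distribʳ-*; -‿involutive)

  signPow-cong : ∀ k {x y} → x ≈ y → signPow F k x ≈ signPow F k y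
  signPow-cong zero    x≈y = x≈y
  signPow-cong (suc k) x≈y = -‿cong (signPow-cong k x≈y)

  signPow-+ : ∀ k x y → signPow F k (x +ᶠ y) ≈ signPow F k x +ᶠ signPow F k y
  signPow-+ zero    x y = ≈-refl
  signPow-+ (suc k) x y = ≈-trans (-‿cong (signPow-+ k x y)) (≈-sym (-‿+-comm _ _))

  signPow-* : ∀ k a x → signPow F k (a *ᶠ x) ≈ a *ᶠ signPow F k x
  signPow-* zero    a x = ≈-refl
  signPow-* (suc k) a x = ≈-trans (-‿cong (signPow-* k a x)) (-‿distribʳ-* a _)

  signPow-∘ : ∀ a b x → signPow F a (signPow F b x) ≡ signPow F (a + b) x
  signPow-∘ zero    b x = ≡.refl
  signPow-∘ (suc a) b x = ≡.cong -_ (signPow-∘ a b x)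

  signPow-%2 : ∀ k x → signPow F k x ≈ signPow F (k % 2) x
  signPow-%2 zero          x = ≈-refl
  signPow-%2 (suc zero)    x = ≈-refl
  signPow-%2 (suc (suc k)) x = ≈-trans (-‿involutive _) (signPow-%2 k x)

  signPow-parity : ∀ a b x → a % 2 ≡ b % 2 → signPow F a x ≈ signPow F b x
  signPow-parity a b x a≡b =
    ≈-trans (signPow-%2 a x) (≈-trans (reflexive (≡.cong (λ k → signPow F k x) a≡b)) (≈-sym (signPow-%2 b x)))

  signPow-involutive : ∀ k x → signPow F k (signPow F k x) ≈ x
  signPow-involutive k x =
    ≈-trans (reflexive (signPow-∘ k k x)) (signPow-parity (k + k) 0 x (≡.trans (≡.cong (_% 2) (double k)) (+2*-%2 0 k)))
    where
    double : ∀ k → k + k ≡ 0 + 2 * k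
    double = solve-∀

module Monomial {c ℓ} (F : Field c ℓ) {I J : Set}
                (b : I → Bool) (e : I → ℕ) (r : I → J) where
  open Field F hiding (zero)
    renaming (_+_ to _+ᶠ_; _*_ to _*ᶠ_; refl to ≈-refl; sym to ≈-sym; trans to ≈-trans)
  open Signs F

  monomial : (J → Carrier) → (I → Carrier)
  monomial v i = if b i then signPow F (e i) (v (r i)) else 0#

  monomial-cong : ∀ v w → (∀ j → v j ≈ w j) → ∀ i → monomial v i ≈ monomial w i
  monomial-cong v w v≈w i with b i
  ... | true  = signPow-cong (e i) (v≈w (r i))
  ... | false = ≈-refl

  monomial-+ : ∀ v w i → monomial (λ j → v j +ᶠ w j) i ≈ monomial v i +ᶠ monomial w i
  monomial-+ v w i with b i
  ... | true  = signPow-+ (e i) (v (r i)) (w (r i))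
  ... | false = ≈-sym (+-identityˡ 0#)

  monomial-* : ∀ a v i → monomial (λ j → a *ᶠ v j) i ≈ a *ᶠ monomial v i
  monomial-* a v i with b i
  ... | true  = signPow-* (e i) a (v (r i))
  ... | false = ≈-sym (zeroʳ a)

  monomial-supported : ∀ v i → b i ≡ false → monomial v i ≈ 0#
  monomial-supported v i bᵢ≡false rewrite bᵢ≡false = ≈-refl

  monomial-basis : ∀ v i → T (b i) → monomial v i ≡ signPow F (e i) (v (r i))
  monomial-basis v i bᵢ with b i
  ... | true = refl

-- A signed correspondence between a monomial representation M (σ sends
-- basis vectors to ± basis vectors) and a permutation representation N:
-- a bijection of bases intertwining the two permutation actions, together
-- with a twist (-1)^twist whose coboundary is the sign of the action on M.
module _ {c ℓ} (F : Field c ℓ) {m : ℕ} (M N : Rep F m) where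
  open Rep

  record SignedCorrespondence : Set c where
    field
      permM  : Permutation′ m → Idx M → Idx M
      signM  : Permutation′ m → Idx M → ℕ
      permN  : Permutation′ m → Idx N → Idx N
      act-M  : ∀ σ v j → act M σ v j ≡ signPow F (signM σ j) (v (permM σ j))
      act-N  : ∀ σ w i → act N σ w i ≡ w (permN σ i)
      enc    : Idx M → Idx N
      dec    : Idx N → Idx M
      twist  : Idx M → ℕ
      enc-basis   : ∀ j → T (basis M j) → T (basis N (enc j))
      dec-basis   : ∀ i → T (basis N i) → T (basis M (dec i))
      dec∘enc     : ∀ j → T (basis M j) → dec (enc j) ≡ j
      enc∘dec     : ∀ i → T (basis N i) → enc (dec i) ≡ i
      permN-basis : ∀ σ i → basis N (permN σ i) ≡ basis N i
      dec-perm    : ∀ σ i → T (basis N i) → dec (permN σ i) ≡ permM σ (dec i)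
      twist-coboundary : ∀ σ i → T (basis N i) →
        (twist (dec i) + signM σ (dec i)) % 2 ≡ twist (permM σ (dec i)) % 2

  signedCorrespondence⇒isomorphic : SignedCorrespondence → Isomorphic F M N
  signedCorrespondence⇒isomorphic χ =
      φ , ψ
    , (Φ.monomial-cong , Φ.monomial-+ , Φ.monomial-*)
    , (Ψ.monomial-cong , Ψ.monomial-+ , Ψ.monomial-*)
    , (λ v _ → Φ.monomial-supported v)
    , (λ w _ → Ψ.monomial-supported w)
    , ψ∘φ
    , φ∘ψ
    , equivariant
    where
    open SignedCorrespondence χ
    open Field F hiding (zero)
      renaming (_+_ to _+ᶠ_; _*_ to _*ᶠ_; refl to ≈-refl; sym to ≈-sym; trans to ≈-trans)
    open Signs F
    open import Relation.Binary.Reasoning.Setoid setoid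

    module Φ = Monomial F (basis N) (λ i → twist (dec i)) dec
    module Ψ = Monomial F (basis M) twist enc

    φ : (Idx M → Carrier) → (Idx N → Carrier)
    φ = Φ.monomial

    ψ : (Idx N → Carrier) → (Idx M → Carrier)
    ψ = Ψ.monomial

    ψ∘φ : ∀ v → Supported F {m} (basis M) v → ∀ j → ψ (φ v) j ≈ v j
    ψ∘φ v supp j with basis M j in bⱼ
    ... | false = ≈-sym (supp j bⱼ)
    ... | true  = begin
      signPow F (twist j) (φ v (enc j))
        ≡⟨ cong (signPow F (twist j)) (Φ.monomial-basis v (enc j) (enc-basis j (T-≡ .Equivalence.from bⱼ))) ⟩
      signPow F (twist j) (signPow F (twist (dec (enc j))) (v (dec (enc j))))
        ≡⟨ cong (λ j′ → signPow F (twist j) (signPow F (twist j′) (v j′))) (dec∘enc j (T-≡ .Equivalence.from bⱼ)) ⟩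
      signPow F (twist j) (signPow F (twist j) (v j))
        ≈⟨ signPow-involutive (twist j) (v j) ⟩
      v j ∎

    φ∘ψ : ∀ w → Supported F {m} (basis N) w → ∀ i → φ (ψ w) i ≈ w i
    φ∘ψ w supp i with basis N i in bᵢ
    ... | false = ≈-sym (supp i bᵢ)
    ... | true  = begin
      signPow F (twist (dec i)) (ψ w (dec i))
        ≡⟨ cong (signPow F (twist (dec i))) (Ψ.monomial-basis w (dec i) (dec-basis i (T-≡ .Equivalence.from bᵢ))) ⟩
      signPow F (twist (dec i)) (signPow F (twist (dec i)) (w (enc (dec i))))
        ≈⟨ signPow-involutive (twist (dec i)) _ ⟩
      w (enc (dec i))
        ≡⟨ cong w (enc∘dec i (T-≡ .Equivalence.from bᵢ)) ⟩
      w i ∎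

    equivariant : ∀ σ v → Supported F {m} (basis M) v → ∀ i → φ (act M σ v) i ≈ act N σ (φ v) i
    equivariant σ v _ i rewrite act-N σ (φ v) i | permN-basis σ i with basis N i in bᵢ
    ... | false = ≈-refl
    ... | true  = begin
      signPow F (twist j) (act M σ v j)
        ≡⟨ cong (signPow F (twist j)) (act-M σ v j) ⟩
      signPow F (twist j) (signPow F (signM σ j) (v (permM σ j)))
        ≡⟨ signPow-∘ (twist j) (signM σ j) _ ⟩
      signPow F (twist j + signM σ j) (v (permM σ j))
        ≈⟨ signPow-parity (twist j + signM σ j) (twist (permM σ j)) _ (twist-coboundary σ i bᵢ′) ⟩
      signPow F (twist (permM σ j)) (v (permM σ j))
        ≡⟨ cong (λ j′ → signPow F (twist j′) (v j′)) (dec-perm σ i bᵢ′) ⟨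
      signPow F (twist (dec (permN σ i))) (v (dec (permN σ i))) ∎
      where
      j : Idx M
      j = dec i
      bᵢ′ : T (basis N i)
      bᵢ′ = T-≡ .Equivalence.from bᵢ

at : ∀ {A : Set} → A → List A → ℕ → A
at x₀ []       r       = x₀
at x₀ (x ∷ xs) zero    = x
at x₀ (x ∷ xs) (suc r) = at x₀ xs r

module _ {A : Set} where

  at-∈ : (x₀ : A) (xs : List A) (r : ℕ) → r < length xs → at x₀ xs r ∈ xs
  at-∈ x₀ (x ∷ xs) zero    _         = here refl
  at-∈ x₀ (x ∷ xs) (suc r) (s≤s r<n) = there (at-∈ x₀ xs r r<n)

  at-map : ∀ {B : Set} (h : A → B) (y₀ : B) (x₀ : A) (xs : List A) (r : ℕ) → r < length xs →
    at y₀ (List.map h xs) r ≡ h (at x₀ xs r)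
  at-map h y₀ x₀ (x ∷ xs) zero    _         = refl
  at-map h y₀ x₀ (x ∷ xs) (suc r) (s≤s r<n) = at-map h y₀ x₀ xs r r<n

module Positions {A : Set} (_≟ₐ_ : DecidableEquality A) (x₀ : A) where

  -- The index of the first occurrence (the length, if there is none).
  position : A → List A → ℕ
  position x []       = 0
  position x (y ∷ ys) with x ≟ₐ y
  ... | yes _ = 0
  ... | no  _ = suc (position x ys)

  position-< : ∀ {x} xs → x ∈ xs → position x xs < length xs
  position-< {x} (y ∷ ys) x∈ with x ≟ₐ y
  ... | yes _ = s≤s z≤n
  position-< {x} (y ∷ ys) (here x≡y)  | no x≢y = contradiction x≡y x≢y
  position-< {x} (y ∷ ys) (there x∈) | no _   = s≤s (position-< ys x∈)

  at-position : ∀ {x} xs → x ∈ xs → at x₀ xs (position x xs) ≡ x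
  at-position {x} (y ∷ ys) x∈ with x ≟ₐ y
  ... | yes x≡y = sym x≡y
  at-position {x} (y ∷ ys) (here x≡y)  | no x≢y = contradiction x≡y x≢y
  at-position {x} (y ∷ ys) (there x∈) | no _   = at-position ys x∈

  position-at : ∀ xs r → Unique xs → r < length xs → position (at x₀ xs r) xs ≡ r
  position-at (y ∷ ys) zero    _          _ with y ≟ₐ y
  ... | yes _   = refl
  ... | no y≢y = contradiction refl y≢y
  position-at (y ∷ ys) (suc r) (y∉ ∷ u) (s≤s r<n) with at x₀ ys r ≟ₐ y
  ... | yes x≡y = contradiction (sym x≡y) (All.lookup y∉ (at-∈ x₀ ys r r<n))
  ... | no _    = cong suc (position-at ys r u r<n)

  position⇔at : ∀ {x} xs r → Unique xs → x ∈ xs → r < length xs →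
    (position x xs ≡ r) ⇔ (x ≡ at x₀ xs r)
  position⇔at {x} xs r u x∈ r<n = mk⇔
    (λ { refl → sym (at-position xs x∈) })
    (λ { refl → position-at xs r u r<n })

-- Insertion sort by decreasing key: it performs the comparisons of
-- sortDesc on the keys, so it sorts the keys exactly as sortDesc does,
-- and it only permutes the list.
module SortOn {A : Set} (key : A → ℕ) where
  open import Data.List.Relation.Binary.Permutation.Setoid.Properties (≡.setoid A) using (Unique-resp-↭)

  insertOn : A → List A → List A
  insertOn x []       = x ∷ []
  insertOn x (y ∷ ys) = if key y <ᵇ key x then x ∷ y ∷ ys else y ∷ insertOn x ys

  sortOn : List A → List A
  sortOn []       = []
  sortOn (x ∷ xs) = insertOn x (sortOn xs)

  keys-insertOn : ∀ x ys → List.map key (insertOn x ys) ≡ insertDesc (key x) (List.map key ys)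
  keys-insertOn x []       = refl
  keys-insertOn x (y ∷ ys) with key y <ᵇ key x
  ... | true  = refl
  ... | false = cong (key y ∷_) (keys-insertOn x ys)

  keys-sortOn : ∀ xs → List.map key (sortOn xs) ≡ sortDesc (List.map key xs)
  keys-sortOn []       = refl
  keys-sortOn (x ∷ xs) = trans (keys-insertOn x (sortOn xs)) (cong (insertDesc (key x)) (keys-sortOn xs))

  insertOn-↭ : ∀ x ys → insertOn x ys ↭ x ∷ ys
  insertOn-↭ x []       = ↭-refl
  insertOn-↭ x (y ∷ ys) with key y <ᵇ key x
  ... | true  = ↭-refl
  ... | false = ↭-trans (↭-prep y (insertOn-↭ x ys)) (↭-swap y x ↭-refl)

  sortOn-↭ : ∀ xs → sortOn xs ↭ xs
  sortOn-↭ []       = ↭-refl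
  sortOn-↭ (x ∷ xs) = ↭-trans (insertOn-↭ x (sortOn xs)) (↭-prep x (sortOn-↭ xs))

  ∈-sortOn : ∀ {x} xs → x ∈ sortOn xs ⇔ x ∈ xs
  ∈-sortOn xs = mk⇔ (∈-resp-↭ (sortOn-↭ xs)) (∈-resp-↭ (↭-sym (sortOn-↭ xs)))

  unique-sortOn : ∀ xs → Unique xs → Unique (sortOn xs)
  unique-sortOn xs = Unique-resp-↭ (↭⇒↭ₛ (↭-sym (sortOn-↭ xs)))

vec-ext : ∀ {A : Set} {k} {u v : Vec A k} → (∀ a → lookup u a ≡ lookup v a) → u ≡ v
vec-ext {u = u} {v} u≗v = trans (sym (VP.tabulate∘lookup u)) (trans (VP.tabulate-cong u≗v) (VP.tabulate∘lookup v))

map-∘ₚ : ∀ {A B : Set} {k} (h : A → B) (t : Vec A k) (σ : Permutation′ k) → V.map h (t ∘ₚ σ) ≡ V.map h t ∘ₚ σ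
map-∘ₚ h t σ = vec-ext λ a → begin
  lookup (V.map h (t ∘ₚ σ)) a   ≡⟨ VP.lookup-map a h (t ∘ₚ σ) ⟩
  h (lookup (t ∘ₚ σ) a)         ≡⟨ cong h (lookup-∘ₚ t σ a) ⟩
  h (lookup t (σ ⟨$⟩ʳ a))       ≡⟨ VP.lookup-map (σ ⟨$⟩ʳ a) h t ⟨
  lookup (V.map h t) (σ ⟨$⟩ʳ a) ≡⟨ lookup-∘ₚ (V.map h t) σ a ⟨
  lookup (V.map h t ∘ₚ σ) a     ∎
  where open ≡-Reasoning

allFinᵇ⇔ : ∀ {k} (p : Fin k → Bool) → T (allFinᵇ p) ⇔ (∀ i → T (p i))
allFinᵇ⇔ {zero}  p = mk⇔ (λ _ ()) (λ _ → _)
allFinᵇ⇔ {suc k} p = mk⇔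
  (λ all → let (p₀ , pₛ) = T-∧ .Equivalence.to all in
    λ { zero → p₀ ; (suc i) → allFinᵇ⇔ (λ i → p (suc i)) .Equivalence.to pₛ i })
  (λ all → T-∧ .Equivalence.from (all zero , allFinᵇ⇔ (λ i → p (suc i)) .Equivalence.from (λ i → all (suc i))))

allᵇ-map⇔ : ∀ {A : Set} {k} (q : A → Bool) (t : Vec A k) →
  T (V.foldr _ _∧_ true (V.map q t)) ⇔ (∀ a → T (q (lookup t a)))
allᵇ-map⇔ q []      = mk⇔ (λ _ ()) (λ _ → _)
allᵇ-map⇔ q (x ∷ t) = mk⇔
  (λ all → let (qx , qt) = T-∧ .Equivalence.to all in
    λ { zero → qx ; (suc a) → allᵇ-map⇔ q t .Equivalence.to qt a })
  (λ all → T-∧ .Equivalence.from (all zero , allᵇ-map⇔ q t .Equivalence.from (λ a → all (suc a))))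

IsRowWord : ∀ {d k} → ℕ → Vec (Fin d) k → Set
IsRowWord n f = ∀ i → countᵇ (λ x → does (x ≟ i)) f ≡ n

isRowWord⇔ : ∀ d n (f : PIdx d n) → T (isRowWord d n f) ⇔ IsRowWord n f
isRowWord⇔ d n f = mk⇔
  (λ row i → ≡ᵇ⇒≡ _ n (allFinᵇ⇔ _ .Equivalence.to row i))
  (λ row → allFinᵇ⇔ _ .Equivalence.from (λ i → ≡⇒≡ᵇ _ n (row i)))

IsCorrelated : ∀ d n → Diagram d → Set
IsCorrelated d n D = (∀ i → V.sum (lookup D i) ≡ n) × (∀ j → V.sum (lookup (transpose D) j) ≡ n)

isCorrelated⇔ : ∀ d n (D : Diagram d) → T (isCorrelated d n D) ⇔ IsCorrelated d n D
isCorrelated⇔ d n D = mk⇔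
  (λ cor → let (rows , cols) = T-∧ .Equivalence.to cor in
      (λ i → ≡ᵇ⇒≡ _ n (allFinᵇ⇔ _ .Equivalence.to rows i))
    , (λ j → ≡ᵇ⇒≡ _ n (allFinᵇ⇔ _ .Equivalence.to cols j)))
  (λ { (rows , cols) → T-∧ .Equivalence.from
    ( allFinᵇ⇔ _ .Equivalence.from (λ i → ≡⇒≡ᵇ _ n (rows i))
    , allFinᵇ⇔ _ .Equivalence.from (λ j → ≡⇒≡ᵇ _ n (cols j))) })

IsTabloid : ∀ {k} → List ℕ → Vec ℕ k → Set
IsTabloid ls t = (∀ a → lookup t a < length ls) × (∀ r → r < length ls → countᵇ (λ x → x ≡ᵇ r) t ≡ at 0 ls r)

rowSizesFrom⇔ : ∀ {k} i ls (t : Vec ℕ k) →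
  T (rowSizesFrom i ls t) ⇔ (∀ r → r < length ls → countᵇ (λ x → x ≡ᵇ (i + r)) t ≡ at 0 ls r)
rowSizesFrom⇔ i []       t = mk⇔ (λ _ _ ()) (λ _ → _)
rowSizesFrom⇔ i (l ∷ ls) t = mk⇔
  (λ sizes → let (first , rest) = T-∧ .Equivalence.to sizes in λ
    { zero    _         → trans (cong (λ j → countᵇ (λ x → x ≡ᵇ j) t) (+-identityʳ i)) (≡ᵇ⇒≡ _ l first)
    ; (suc r) (s≤s r<n) → trans (cong (λ j → countᵇ (λ x → x ≡ᵇ j) t) (+-suc i r))
                                 (rowSizesFrom⇔ (suc i) ls t .Equivalence.to rest r r<n) })
  (λ sizes → T-∧ .Equivalence.from
    ( ≡⇒≡ᵇ _ l (trans (cong (λ j → countᵇ (λ x → x ≡ᵇ j) t) (sym (+-identityʳ i))) (sizes zero (s≤s z≤n)))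
    , rowSizesFrom⇔ (suc i) ls t .Equivalence.from (λ r r<n →
        trans (cong (λ j → countᵇ (λ x → x ≡ᵇ j) t) (sym (+-suc i r))) (sizes (suc r) (s≤s r<n)))))

isTabloid⇔ : ∀ {k} ls (t : Vec ℕ k) → T (isTabloid ls t) ⇔ IsTabloid ls t
isTabloid⇔ ls t = mk⇔
  (λ tab → let (bounded , sizes) = T-∧ .Equivalence.to tab in
    (λ a → <ᵇ⇒< _ _ (allᵇ-map⇔ _ t .Equivalence.to bounded a)) , rowSizesFrom⇔ 0 ls t .Equivalence.to sizes)
  (λ { (bounded , sizes) → T-∧ .Equivalence.from
    (allᵇ-map⇔ _ t .Equivalence.from (λ a → <⇒<ᵇ (bounded a)) , rowSizesFrom⇔ 0 ls t .Equivalence.from sizes) })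

isTabloid-∘ₚ : ∀ {k} ls (t : Vec ℕ k) (σ : Permutation′ k) → isTabloid ls (t ∘ₚ σ) ≡ isTabloid ls t
isTabloid-∘ₚ ls t σ = T-≡-ext (mk⇔
  (λ tab → let (bounded , sizes) = isTabloid⇔ ls (t ∘ₚ σ) .Equivalence.to tab in isTabloid⇔ ls t .Equivalence.from
    ( (λ a → subst (_< length ls) (trans (lookup-∘ₚ t σ (σ ⟨$⟩ˡ a)) (cong (lookup t) (inverseʳ σ)))
                   (bounded (σ ⟨$⟩ˡ a)))
    , (λ r r<n → trans (sym (countᵇ-∘ₚ _ t σ)) (sizes r r<n)) ))
  (λ tab → let (bounded , sizes) = isTabloid⇔ ls t .Equivalence.to tab in isTabloid⇔ ls (t ∘ₚ σ) .Equivalence.from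
    ( (λ a → subst (_< length ls) (sym (lookup-∘ₚ t σ a)) (bounded (σ ⟨$⟩ʳ a)))
    , (λ r r<n → trans (countᵇ-∘ₚ _ t σ) (sizes r r<n)) )))

Cell : ℕ → Set
Cell d = Fin d × Fin d

_≟ᶜ_ : ∀ {d} → DecidableEquality (Cell d)
c ≟ᶜ e = map′ (λ (p , q) → cong₂ _,_ p q) (λ c≡e → cong proj₁ c≡e , cong proj₂ c≡e)
              ((proj₁ c ≟ proj₁ e) ×-dec (proj₂ c ≟ proj₂ e))

entry : ∀ {d} → Diagram d → Cell d → ℕ
entry D c = lookup (lookup D (proj₁ c)) (proj₂ c)

diagramOf : ∀ {d k} → Vec (Cell d) k → Diagram d
diagramOf w = tabulate λ i → tabulate λ j → countᵇ (λ x → does (x ≟ᶜ (i , j))) w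

entry-diagramOf : ∀ {d k} (w : Vec (Cell d) k) c → entry (diagramOf w) c ≡ countᵇ (λ x → does (x ≟ᶜ c)) w
entry-diagramOf w (i , j) = trans (cong (λ r → lookup r j) (VP.lookup∘tabulate _ i)) (VP.lookup∘tabulate _ j)

lookup-transpose : ∀ {A : Set} {m k} (D : Vec (Vec A m) k) j → lookup (transpose D) j ≡ V.map (λ r → lookup r j) D
lookup-transpose []         j = VP.lookup-replicate j []
lookup-transpose (as ∷ ass) j = begin
  lookup ((V.replicate _ V._∷_ V.⊛ as) V.⊛ transpose ass) j
    ≡⟨ VP.lookup-⊛ j (V.replicate _ V._∷_ V.⊛ as) (transpose ass) ⟩
  lookup (V.replicate _ V._∷_ V.⊛ as) j (lookup (transpose ass) j)
    ≡⟨ cong₂ (λ h x → h x) (trans (VP.lookup-⊛ j (V.replicate _ V._∷_) as)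
                                   (cong (λ h → h (lookup as j)) (VP.lookup-replicate j V._∷_)))
                            (lookup-transpose ass j) ⟩
  lookup as j ∷ V.map (λ r → lookup r j) ass ∎
  where open ≡-Reasoning

sumᵛ≡sum : ∀ {k} (v : Vec ℕ k) → V.sum v ≡ sum (lookup v)
sumᵛ≡sum v = trans (cong V.sum (sym (VP.tabulate∘lookup v))) (sumFin≡sum (lookup v))

rowSum≡ : ∀ {d} (D : Diagram d) i → V.sum (lookup D i) ≡ sum (λ j → entry D (i , j))
rowSum≡ D i = sumᵛ≡sum (lookup D i)

colSum≡ : ∀ {d} (D : Diagram d) j → V.sum (lookup (transpose D) j) ≡ sum (λ i → entry D (i , j))
colSum≡ {d} D j = trans (cong V.sum (lookup-transpose D j))
  (trans (sumᵛ≡sum (V.map (λ r → lookup r j) D)) (sum-cong-≗ {d} (λ i → VP.lookup-map i (λ r → lookup r j) D)))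

count-fibres : ∀ {A : Set} {d k} (w : Vec A k) (p : A → Fin d → Bool) (q : A → Bool) →
  (∀ x → sum (λ j → 𝟙 (p x j)) ≡ 𝟙 (q x)) → sum (λ j → countᵇ (λ x → p x j) w) ≡ countᵇ q w
count-fibres {d = d} {k} w p q fibre = begin
  sum (λ j → countᵇ (λ x → p x j) w)               ≡⟨ sum-cong-≗ {d} (λ j → countᵇ≡sum (λ x → p x j) w) ⟩
  sum (λ j → sum (λ a → 𝟙 (p (lookup w a) j)))     ≡⟨ ∑-comm (λ j a → 𝟙 (p (lookup w a) j)) ⟩
  sum (λ a → sum (λ j → 𝟙 (p (lookup w a) j)))     ≡⟨ sum-cong-≗ {k} (λ a → fibre (lookup w a)) ⟩
  sum (λ a → 𝟙 (q (lookup w a)))                   ≡⟨ countᵇ≡sum q w ⟨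
  countᵇ q w                                       ∎
  where open ≡-Reasoning

sum-∧-δ : ∀ {d} x (i : Fin d) → sum (λ j → 𝟙 (x ∧ does (i ≟ j))) ≡ 𝟙 x
sum-∧-δ     true  i = sum-δ i
sum-∧-δ {d} false i = sum-zero {d} (λ _ → 0) (λ _ → refl)

sum-δ-∧ : ∀ {d} x (i : Fin d) → sum (λ j → 𝟙 (does (i ≟ j) ∧ x)) ≡ 𝟙 x
sum-δ-∧ {d} x i = trans (sum-cong-≗ {d} (λ j → cong 𝟙 (∧-comm (does (i ≟ j)) x))) (sum-∧-δ x i)

rowSum-diagramOf : ∀ {d k} (w : Vec (Cell d) k) i →
  V.sum (lookup (diagramOf w) i) ≡ countᵇ (λ x → does (x ≟ i)) (V.map proj₁ w)
rowSum-diagramOf {d} w i = begin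
  V.sum (lookup (diagramOf w) i)                    ≡⟨ rowSum≡ (diagramOf w) i ⟩
  sum (λ j → entry (diagramOf w) (i , j))           ≡⟨ sum-cong-≗ {d} (λ j → entry-diagramOf w (i , j)) ⟩
  sum (λ j → countᵇ (λ x → does (x ≟ᶜ (i , j))) w) ≡⟨ count-fibres w (λ x j → does (x ≟ᶜ (i , j))) _
                                                       (λ x → sum-∧-δ (does (proj₁ x ≟ i)) (proj₂ x)) ⟩
  countᵇ (λ x → does (proj₁ x ≟ i)) w               ≡⟨ countᵇ-map _ proj₁ w ⟨
  countᵇ (λ x → does (x ≟ i)) (V.map proj₁ w)       ∎
  where open ≡-Reasoning

colSum-diagramOf : ∀ {d k} (w : Vec (Cell d) k) j →
  V.sum (lookup (transpose (diagramOf w)) j) ≡ countᵇ (λ x → does (x ≟ j)) (V.map proj₂ w)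
colSum-diagramOf {d} w j = begin
  V.sum (lookup (transpose (diagramOf w)) j)        ≡⟨ colSum≡ (diagramOf w) j ⟩
  sum (λ i → entry (diagramOf w) (i , j))           ≡⟨ sum-cong-≗ {d} (λ i → entry-diagramOf w (i , j)) ⟩
  sum (λ i → countᵇ (λ x → does (x ≟ᶜ (i , j))) w) ≡⟨ count-fibres w (λ x i → does (x ≟ᶜ (i , j))) _
                                                       (λ x → sum-δ-∧ (does (proj₂ x ≟ j)) (proj₁ x)) ⟩
  countᵇ (λ x → does (proj₂ x ≟ j)) w               ≡⟨ countᵇ-map _ proj₂ w ⟨
  countᵇ (λ x → does (x ≟ j)) (V.map proj₂ w)       ∎
  where open ≡-Reasoning

nonzero? : (x : ℕ) → Dec (not (x ≡ᵇ 0) ≡ true)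
nonzero? x = not (x ≡ᵇ 0) Bool.≟ true

nonzero⇔ : ∀ x → (not (x ≡ᵇ 0) ≡ true) ⇔ (¬ x ≡ 0)
nonzero⇔ zero    = mk⇔ (λ ()) (λ x≢0 → contradiction refl x≢0)
nonzero⇔ (suc x) = mk⇔ (λ _ ()) (λ _ → refl)

filter-map : ∀ {A : Set} (h : A → ℕ) (xs : List A) →
  List.map h (List.filter (λ x → nonzero? (h x)) xs) ≡ List.filter nonzero? (List.map h xs)
filter-map h []       = refl
filter-map h (x ∷ xs) with does (nonzero? (h x))
... | true  = cong (h x ∷_) (filter-map h xs)
... | false = filter-map h xs

allCells : ∀ d → List (Cell d)
allCells d = cartesianProduct (allFin d) (allFin d)

entries-rows : ∀ {r m} (D : Vec (Vec ℕ m) r) {X : Set} (row : Fin r → X) (W : X → Fin m → ℕ) →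
  (∀ i j → W (row i) j ≡ lookup (lookup D i) j) →
  List.map (λ c → W (proj₁ c) (proj₂ c)) (cartesianProduct (List.tabulate row) (allFin m)) ≡ toList (concat D)
entries-rows []                  row W W≡D = refl
entries-rows {m = m} (x ∷ xs) {X} row W W≡D = begin
  List.map W′ (List.map (row zero ,_) (allFin m) ++ cartesianProduct (List.tabulate (λ i → row (suc i))) (allFin m))
    ≡⟨ LP.map-++ W′ (List.map (row zero ,_) (allFin m)) _ ⟩
  List.map W′ (List.map (row zero ,_) (allFin m)) ++ List.map W′ (cartesianProduct (List.tabulate (λ i → row (suc i))) (allFin m))
    ≡⟨ cong₂ _++_ first-row (entries-rows xs (λ i → row (suc i)) W (λ i → W≡D (suc i))) ⟩
  toList x ++ toList (concat xs)
    ≡⟨ VP.toList-++ x (concat xs) ⟨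
  toList (concat (x ∷ xs)) ∎
  where
  open ≡-Reasoning
  W′ : X × Fin m → ℕ
  W′ c = W (proj₁ c) (proj₂ c)
  first-row : List.map W′ (List.map (row zero ,_) (allFin m)) ≡ toList x
  first-row = begin
    List.map W′ (List.map (row zero ,_) (allFin m)) ≡⟨ LP.map-∘ (allFin m) ⟨
    List.map (W (row zero)) (allFin m)             ≡⟨ LP.map-cong (W≡D zero) (allFin m) ⟩
    List.map (lookup x) (allFin m)                 ≡⟨ LP.map-tabulate (λ j → j) (lookup x) ⟩
    List.tabulate (lookup x)                       ≡⟨ tabulate-lookup x ⟩
    toList x                                       ∎
    where
    tabulate-lookup : ∀ {n} (v : Vec ℕ n) → List.tabulate (lookup v) ≡ toList v
    tabulate-lookup []      = refl
    tabulate-lookup (y ∷ v) = cong (y ∷_) (tabulate-lookup v)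

cellsOf : ∀ {d} → Diagram d → List (Cell d)
cellsOf {d} D = SortOn.sortOn (entry D) (List.filter (λ c → nonzero? (entry D c)) (allCells d))

cellsOf-shape : ∀ {d} (D : Diagram d) → List.map (entry D) (cellsOf D) ≡ δ D
cellsOf-shape {d} D = begin
  List.map (entry D) (cellsOf D)
    ≡⟨ keys-sortOn (List.filter (λ c → nonzero? (entry D c)) (allCells d)) ⟩
  sortDesc (List.map (entry D) (List.filter (λ c → nonzero? (entry D c)) (allCells d)))
    ≡⟨ cong sortDesc (filter-map (entry D) (allCells d)) ⟩
  sortDesc (List.filter nonzero? (List.map (entry D) (allCells d)))
    ≡⟨ cong (λ es → sortDesc (List.filter nonzero? es))
            (entries-rows D (λ i → i) (λ i j → entry D (i , j)) (λ i j → refl)) ⟩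
  δ D ∎
  where
  open ≡-Reasoning
  open SortOn (entry D)

cellsOf-unique : ∀ {d} (D : Diagram d) → Unique (cellsOf D)
cellsOf-unique {d} D = SortOn.unique-sortOn (entry D) _
  (UP.filter⁺ (λ c → nonzero? (entry D c)) (UP.cartesianProduct⁺ (UP.allFin⁺ d) (UP.allFin⁺ d)))

∈-cellsOf⇔ : ∀ {d} (D : Diagram d) c → c ∈ cellsOf D ⇔ (¬ entry D c ≡ 0)
∈-cellsOf⇔ {d} D c = mk⇔
  (λ c∈ → nonzero⇔ (entry D c) .Equivalence.to
            (proj₂ (∈-filter⁻ (λ c → nonzero? (entry D c)) {xs = allCells d}
                               (SortOn.∈-sortOn (entry D) _ .Equivalence.to c∈))))
  (λ c≢0 → SortOn.∈-sortOn (entry D) _ .Equivalence.from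
            (∈-filter⁺ (λ c → nonzero? (entry D c)) (∈-cartesianProduct⁺ (∈-allFin (proj₁ c)) (∈-allFin (proj₂ c)))
                       (nonzero⇔ (entry D c) .Equivalence.from c≢0)))

-- The default cell c₀ is only used outside the relevant range.
module Encoding {d : ℕ} (c₀ : Cell d) where
  open Positions _≟ᶜ_ c₀

  cellAt : Diagram d → ℕ → Cell d
  cellAt D r = at c₀ (cellsOf D) r

  rowOf : Diagram d → Cell d → ℕ
  rowOf D c = position c (cellsOf D)

  encodeCells : ∀ {k} → Vec (Cell d) k → Diagram d × Vec ℕ k
  encodeCells w = diagramOf w , V.map (rowOf (diagramOf w)) w

  encode : ∀ {k} → Vec (Fin d) k × Vec (Fin d) k → Diagram d × Vec ℕ k
  encode (f , g) = encodeCells (zip f g)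

  cellWord : ∀ {k} → Diagram d → Vec ℕ k → Vec (Cell d) k
  cellWord D t = V.map (cellAt D) t

  decode : ∀ {k} → Diagram d × Vec ℕ k → Vec (Fin d) k × Vec (Fin d) k
  decode (D , t) = V.map proj₁ (cellWord D t) , V.map proj₂ (cellWord D t)

  length-cellsOf : ∀ (D : Diagram d) → length (cellsOf D) ≡ length (δ D)
  length-cellsOf D = trans (sym (LP.length-map (entry D) (cellsOf D))) (cong length (cellsOf-shape D))

  shape-at : ∀ (D : Diagram d) r → r < length (cellsOf D) → at 0 (δ D) r ≡ entry D (cellAt D r)
  shape-at D r r<n = trans (cong (λ l → at 0 l r) (sym (cellsOf-shape D))) (at-map (entry D) 0 c₀ (cellsOf D) r r<n)

  rowOf-≡ᵇ : ∀ (D : Diagram d) c r → c ∈ cellsOf D → r < length (cellsOf D) →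
    (rowOf D c ≡ᵇ r) ≡ does (c ≟ᶜ cellAt D r)
  rowOf-≡ᵇ D c r c∈ r<n =
    does-⇔ (position⇔at (cellsOf D) r (cellsOf-unique D) c∈ r<n) (rowOf D c ≟ℕ r) (c ≟ᶜ cellAt D r)

  occurs-in-cellsOf : ∀ {k} (w : Vec (Cell d) k) a → lookup w a ∈ cellsOf (diagramOf w)
  occurs-in-cellsOf w a = ∈-cellsOf⇔ (diagramOf w) (lookup w a) .Equivalence.from λ entry≡0 →
    countᵇ-some (λ x → does (x ≟ᶜ lookup w a)) w a (dec-true (lookup w a ≟ᶜ lookup w a) refl)
                (trans (sym (entry-diagramOf w (lookup w a))) entry≡0)

  cellWord-encodeCells : ∀ {k} (w : Vec (Cell d) k) → cellWord (diagramOf w) (V.map (rowOf (diagramOf w)) w) ≡ w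
  cellWord-encodeCells w = vec-ext λ a → begin
    lookup (V.map (cellAt D) (V.map (rowOf D) w)) a ≡⟨ VP.lookup-map a (cellAt D) (V.map (rowOf D) w) ⟩
    cellAt D (lookup (V.map (rowOf D) w) a)        ≡⟨ cong (cellAt D) (VP.lookup-map a (rowOf D) w) ⟩
    cellAt D (rowOf D (lookup w a))                ≡⟨ at-position (cellsOf D) (occurs-in-cellsOf w a) ⟩
    lookup w a                                     ∎
    where
    open ≡-Reasoning
    D : Diagram d
    D = diagramOf w

  decode∘encode : ∀ {k} (f g : Vec (Fin d) k) → decode (encode (f , g)) ≡ (f , g)
  decode∘encode f g rewrite cellWord-encodeCells (zip f g) = cong₂ _,_ (VP.map-proj₁-zip f g) (VP.map-proj₂-zip f g)

  encode-tabloid : ∀ {k} (w : Vec (Cell d) k) → IsTabloid (δ (diagramOf w)) (V.map (rowOf (diagramOf w)) w)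
  encode-tabloid w = bounded , sizes
    where
    D : Diagram d
    D = diagramOf w
    bounded : ∀ a → lookup (V.map (rowOf D) w) a < length (δ D)
    bounded a = subst₂ _<_ (sym (VP.lookup-map a (rowOf D) w)) (length-cellsOf D)
                           (position-< (cellsOf D) (occurs-in-cellsOf w a))
    sizes : ∀ r → r < length (δ D) → countᵇ (λ x → x ≡ᵇ r) (V.map (rowOf D) w) ≡ at 0 (δ D) r
    sizes r r<δ = begin
      countᵇ (λ x → x ≡ᵇ r) (V.map (rowOf D) w) ≡⟨ countᵇ-map _ (rowOf D) w ⟩
      countᵇ (λ c → rowOf D c ≡ᵇ r) w           ≡⟨ countᵇ-cong _ _ w (λ a →
                                                     rowOf-≡ᵇ D (lookup w a) r (occurs-in-cellsOf w a) r<n) ⟩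
      countᵇ (λ c → does (c ≟ᶜ cellAt D r)) w   ≡⟨ entry-diagramOf w (cellAt D r) ⟨
      entry D (cellAt D r)                      ≡⟨ shape-at D r r<n ⟨
      at 0 (δ D) r                              ∎
      where
      open ≡-Reasoning
      r<n : r < length (cellsOf D)
      r<n = subst (r <_) (sym (length-cellsOf D)) r<δ

  encode-correlated : ∀ {n k} (f g : Vec (Fin d) k) → IsRowWord n f → IsRowWord n g →
    IsCorrelated d n (diagramOf (zip f g))
  encode-correlated f g f-rows g-rows =
      (λ i → trans (rowSum-diagramOf (zip f g) i) (trans (cong (countᵇ _) (VP.map-proj₁-zip f g)) (f-rows i)))
    , (λ j → trans (colSum-diagramOf (zip f g) j) (trans (cong (countᵇ _) (VP.map-proj₂-zip f g)) (g-rows j)))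

  decode-∘ₚ : ∀ {k} D (t : Vec ℕ k) σ →
    decode (D , t ∘ₚ σ) ≡ (proj₁ (decode (D , t)) ∘ₚ σ , proj₂ (decode (D , t)) ∘ₚ σ)
  decode-∘ₚ D t σ = cong₂ _,_
    (trans (cong (V.map proj₁) (map-∘ₚ (cellAt D) t σ)) (map-∘ₚ proj₁ (cellWord D t) σ))
    (trans (cong (V.map proj₂) (map-∘ₚ (cellAt D) t σ)) (map-∘ₚ proj₂ (cellWord D t) σ))

  module Decoding {k} (D : Diagram d) (t : Vec ℕ k) (tab : IsTabloid (δ D) t) where

    in-range : ∀ a → lookup t a < length (cellsOf D)
    in-range a = subst (lookup t a <_) (sym (length-cellsOf D)) (proj₁ tab a)

    row-size : ∀ r → r < length (cellsOf D) → countᵇ (λ x → x ≡ᵇ r) t ≡ entry D (cellAt D r)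
    row-size r r<n = trans (proj₂ tab r (subst (r <_) (length-cellsOf D) r<n)) (shape-at D r r<n)

    cellAt-≟ : ∀ c r → c ∈ cellsOf D → r < length (cellsOf D) → does (cellAt D r ≟ᶜ c) ≡ (r ≡ᵇ rowOf D c)
    cellAt-≟ c r c∈ r<n = begin
      does (cellAt D r ≟ᶜ c) ≡⟨ does-⇔ (mk⇔ sym sym) (cellAt D r ≟ᶜ c) (c ≟ᶜ cellAt D r) ⟩
      does (c ≟ᶜ cellAt D r) ≡⟨ rowOf-≡ᵇ D c r c∈ r<n ⟨
      (rowOf D c ≡ᵇ r)       ≡⟨ does-⇔ (mk⇔ sym sym) (rowOf D c ≟ℕ r) (r ≟ℕ rowOf D c) ⟩
      (r ≡ᵇ rowOf D c)       ∎
      where open ≡-Reasoning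

    count-cell : ∀ c → countᵇ (λ r → does (cellAt D r ≟ᶜ c)) t ≡ entry D c
    count-cell c with entry D c ≟ℕ 0
    ... | yes entry≡0 = trans (countᵇ-none _ t (λ a → dec-false (cellAt D (lookup t a) ≟ᶜ c) (not-c a))) (sym entry≡0)
      where
      not-c : ∀ a → ¬ cellAt D (lookup t a) ≡ c
      not-c a refl = ∈-cellsOf⇔ D _ .Equivalence.to (at-∈ c₀ (cellsOf D) (lookup t a) (in-range a)) entry≡0
    ... | no entry≢0 = begin
      countᵇ (λ r → does (cellAt D r ≟ᶜ c)) t ≡⟨ countᵇ-cong _ _ t (λ a → cellAt-≟ c (lookup t a) c∈ (in-range a)) ⟩
      countᵇ (λ r → r ≡ᵇ rowOf D c) t         ≡⟨ row-size (rowOf D c) (position-< (cellsOf D) c∈) ⟩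
      entry D (cellAt D (rowOf D c))          ≡⟨ cong (entry D) (at-position (cellsOf D) c∈) ⟩
      entry D c                               ∎
      where
      open ≡-Reasoning
      c∈ : c ∈ cellsOf D
      c∈ = ∈-cellsOf⇔ D c .Equivalence.from entry≢0

    diagramOf-cellWord : diagramOf (cellWord D t) ≡ D
    diagramOf-cellWord = vec-ext λ i → vec-ext λ j →
      trans (entry-diagramOf (cellWord D t) (i , j)) (trans (countᵇ-map _ (cellAt D) t) (count-cell (i , j)))

    rowOf-cellWord : V.map (rowOf D) (cellWord D t) ≡ t
    rowOf-cellWord = vec-ext λ a →
      trans (VP.lookup-map a (rowOf D) (cellWord D t))
            (trans (cong (rowOf D) (VP.lookup-map a (cellAt D) t))
                   (position-at (cellsOf D) (lookup t a) (cellsOf-unique D) (in-range a)))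

    encode∘decode : encode (decode (D , t)) ≡ (D , t)
    encode∘decode = trans (cong encodeCells zip-decode) encodeCells-cellWord
      where
      zip-decode : zip (V.map proj₁ (cellWord D t)) (V.map proj₂ (cellWord D t)) ≡ cellWord D t
      zip-decode = trans (sym (VP.map-<,>-zip proj₁ proj₂ (cellWord D t))) (VP.map-id (cellWord D t))
      encodeCells-cellWord : encodeCells (cellWord D t) ≡ (D , t)
      encodeCells-cellWord rewrite diagramOf-cellWord = cong (D ,_) rowOf-cellWord

    decode-rowWords : ∀ {n} → IsCorrelated d n D →
      IsRowWord n (proj₁ (decode (D , t))) × IsRowWord n (proj₂ (decode (D , t)))
    decode-rowWords (rows , cols) =
        (λ i → trans (sym (rowSum-diagramOf (cellWord D t) i))
                     (trans (cong (λ E → V.sum (lookup E i)) diagramOf-cellWord) (rows i)))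
      , (λ j → trans (sym (colSum-diagramOf (cellWord D t) j))
                     (trans (cong (λ E → V.sum (lookup (transpose E) j)) diagramOf-cellWord) (cols j)))

module TensorSquare {c ℓ} (F : Field c ℓ) (n d′ : ℕ) where
  d : ℕ
  d = suc d′

  open Encoding {d} (zero , zero)

  M N : Rep F (d * n)
  M = PtensorPbar F d n
  N = SumR F d n

  encode-basis : ∀ j → T (Rep.basis M j) → T (Rep.basis N (encode j))
  encode-basis (f , g) rows =
    let (f-rows , g-rows) = T-∧ .Equivalence.to rows
        (D , t) = encode (f , g) in
    T-∧ {isCorrelated d n D} {isTabloid (δ D) t} .Equivalence.from
      ( isCorrelated⇔ d n D .Equivalence.from
          (encode-correlated f g (isRowWord⇔ d n f .Equivalence.to f-rows) (isRowWord⇔ d n g .Equivalence.to g-rows))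
      , isTabloid⇔ (δ D) t .Equivalence.from (encode-tabloid (zip f g)) )

  tabloid : ∀ i → T (Rep.basis N i) → IsTabloid (δ (proj₁ i)) (proj₂ i)
  tabloid (D , t) basis =
    isTabloid⇔ (δ D) t .Equivalence.to (proj₂ (T-∧ {isCorrelated d n D} .Equivalence.to basis))

  decode-basis : ∀ i → T (Rep.basis N i) → T (Rep.basis M (decode i))
  decode-basis (D , t) basis =
    let (f-rows , g-rows) = Decoding.decode-rowWords D t (tabloid (D , t) basis)
                              (isCorrelated⇔ d n D .Equivalence.to (proj₁ (T-∧ {isCorrelated d n D} .Equivalence.to basis)))
        (f , g) = decode (D , t) in
    T-∧ {isRowWord d n f} {isRowWord d n g} .Equivalence.from
      (isRowWord⇔ d n f .Equivalence.from f-rows , isRowWord⇔ d n g .Equivalence.from g-rows)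

  twist-coboundary : ∀ σ (i : Rep.Idx N) →
    let (f , g) = decode i in
    (inversions (letters f) + inversions (letters g) + (rowInversions σ (f ∘ₚ σ) + rowInversions σ (g ∘ₚ σ))) % 2
    ≡ (inversions (letters (f ∘ₚ σ)) + inversions (letters (g ∘ₚ σ))) % 2
  twist-coboundary σ i =
    let (f , g) = decode i in
    coboundary-parity (inversions (letters f)) (inversions (letters g))
                      (inversions (letters (f ∘ₚ σ))) (inversions (letters (g ∘ₚ σ)))
                      (rowInversions σ (f ∘ₚ σ)) (rowInversions σ (g ∘ₚ σ)) (inversions (images σ))
                      (rowInversions-parity f σ) (rowInversions-parity g σ)

  correspondence : SignedCorrespondence F M N
  correspondence = record
    { permM = λ σ j → (proj₁ j ∘ₚ σ , proj₂ j ∘ₚ σ)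
    ; signM = λ σ j → rowInversions σ (proj₁ j ∘ₚ σ) + rowInversions σ (proj₂ j ∘ₚ σ)
    ; permN = λ σ i → (proj₁ i , proj₂ i ∘ₚ σ)
    ; act-M = λ _ _ _ → refl
    ; act-N = λ _ _ _ → refl
    ; enc   = encode
    ; dec   = decode
    ; twist = λ j → inversions (letters (proj₁ j)) + inversions (letters (proj₂ j))
    ; enc-basis   = encode-basis
    ; dec-basis   = decode-basis
    ; dec∘enc     = λ j _ → decode∘encode (proj₁ j) (proj₂ j)
    ; enc∘dec     = λ i basis → Decoding.encode∘decode (proj₁ i) (proj₂ i) (tabloid i basis)
    ; permN-basis = λ σ i → cong (isCorrelated d n (proj₁ i) ∧_) (isTabloid-∘ₚ (δ (proj₁ i)) (proj₂ i) σ)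
    ; dec-perm    = λ σ i _ → decode-∘ₚ (proj₁ i) (proj₂ i) σ
    ; twist-coboundary = λ σ i _ → twist-coboundary σ i
    }

mainTheorem5 : ∀ {c ℓ} (F : Field c ℓ) → CharacteristicZero F →
    (n d : ℕ) → 1 ≤ n → 1 ≤ d →
    Isomorphic F (PtensorPbar F d n) (SumR F d n)
mainTheorem5 F _ n zero    _ ()
mainTheorem5 F _ n (suc d′) _ _ =
  signedCorrespondence⇒isomorphic F _ _ (TensorSquare.correspondence F n d′)
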